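{- Let $\mathcal V=(1,Q,\Delta)$ be a 1-dimensional VASS, $s,t\in Q$ and $m,n\in\mathbb N$. Then $t(n)$ is coverable from $s(m)$ in $\mathcal V$ under monus semantics if and only if either $t(n)$ is coverable from $s(m)$ in $\mathcal V$ under classical semantics, or there is a state $q\in Q$ such that $t(n)$ is coverable from $q(0)$ in $\mathcal V$ under classical semantics and $s(m)$ is coverable from $q(0)$ in $\mathcal V^{\mathrm{rev}}$ under classical semantics.
   Context: A 1-dimensional VASS is $\mathcal V=(1,Q,\Delta)$ with $Q$ a finite set of states and $\Delta\subseteq Q\times\mathbb Z\times Q$ finite; configurations are $p(u)$ with $p\in Q$, $u\in\mathbb N$. Classical semantics: a transition $(p,z,q)$ takes $p(u)$ to $q(u+z)$, allowed only if $u+z\ge0$. Monus semantics: $(p,z,q)$ takes $p(u)$ to $q(\max(u+z,0))$, always allowed. A configuration $t(n)$ is coverable from $s(m)$ (in a given semantics) if some $t(n')$ with $n'\ge n$ is reachable from $s(m)$ by a finite sequence of steps in that semantics. The reversed VASS $\mathcal V^{\mathrm{rev}}=(1,Q,\Delta^{\mathrm{rev}})$ has a transition $(p,z,q)$ iff $(q,-z,p)\in\Delta$. -}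

module Defs where

open import Data.Nat using (ℕ; _≤_; _⊔_)
open import Data.Integer using (ℤ; +_; _+_; -_; ∣_∣; _≥_; 0ℤ)
open import Data.Fin using (Fin)
open import Data.List using (List; map)
open import Data.List.Membership.Propositional using (_∈_)
open import Data.Product using (_×_; _,_; Σ; ∃-syntax)
open import Relation.Binary.PropositionalEquality using (_≡_)

record VASS1 : Set where
  constructor vass
  field
    k : ℕ
    Δ : List (Fin k × ℤ × Fin k)

open VASS1 public

State : VASS1 → Set
State V = Fin (k V)

Config : VASS1 → Set
Config V = State V × ℕ

revTrans : {k : ℕ} → Fin k × ℤ × Fin k → Fin k × ℤ × Fin k
revTrans (p , z , q) = (q , - z , p)

rev : VASS1 → VASS1
rev (vass k Δ) = vass k (map revTrans Δ)

data StepC (V : VASS1) : Config V → Config V → Set where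
  stepC : ∀ {p z q u} → (p , z , q) ∈ Δ V → (+ u + z) ≥ 0ℤ →
          StepC V (p , u) (q , ∣ + u + z ∣)

max0 : ℤ → ℕ
max0 (+ n) = n
max0 _ = 0

data StepM (V : VASS1) : Config V → Config V → Set where
  stepM : ∀ {p z q u} → (p , z , q) ∈ Δ V →
          StepM V (p , u) (q , max0 (+ u + z))

data Star {A : Set} (R : A → A → Set) : A → A → Set where
  ε   : ∀ {x} → Star R x x
  _◅_ : ∀ {x y z} → R x y → Star R y z → Star R x z

ReachC ReachM : (V : VASS1) → Config V → Config V → Set
ReachC V = Star (StepC V)
ReachM V = Star (StepM V)

CoverC CoverM : (V : VASS1) → State V → ℕ → State V → ℕ → Set
CoverC V s m t n = ∃[ n' ] (n ≤ n' × ReachC V (s , m) (t , n'))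
CoverM V s m t n = ∃[ n' ] (n ≤ n' × ReachM V (s , m) (t , n'))

{-# OPTIONS --safe #-}
-- A monus run from s(m) that never truncates is a classical run. Otherwise
-- split it at its last truncation, in some state q with counter 0: the rest
-- is classical, and the prefix s(m) →* q(0) is dual to a classical run of the
-- reversed VASS. Indeed a monus step p(u) → q(max(u+z,0)) with
-- max(u+z,0) ≤ v reverses to the classical step q(v) → p(v−z) with v−z ≥ u,
-- and conversely, so monus reachability of q(0) from s(m) coincides with
-- coverability of s(m) from q(0) in the reversed VASS.
module Submission where

open import Defs
open import Data.Nat using (ℕ; _≤_; z≤n)
open import Data.Nat.Properties using (≤-reflexive)
open import Data.Product using (_×_; ∃-syntax; _,_)
open import Data.Sum using (_⊎_; inj₁; inj₂)
open import Function.Bundles using (_⇔_; mk⇔)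

open import Data.Integer as ℤ using (+_; -[1+_]; _+_; _-_; ∣_∣; 0ℤ; +≤+; -≤+)
import Data.Integer.Properties as ℤₚ
open import Algebra.Bundles using (AbelianGroup)
open import Algebra.Properties.Group (AbelianGroup.group ℤₚ.+-0-abelianGroup)
  using (//-rightDividesˡ; //-rightDividesʳ)
open import Data.List.Membership.Propositional using (_∈_)
open import Data.List.Membership.Propositional.Properties using (∈-map⁺; ∈-map⁻)
open import Relation.Binary.PropositionalEquality using (_≡_; refl; sym; subst)
open import Relation.Nullary using (¬_; yes; no)

_◅◅_ : ∀ {A : Set} {R : A → A → Set} {x y z} → Star R x y → Star R y z → Star R x z
ε ◅◅ t = t
(r ◅ s) ◅◅ t = r ◅ (s ◅◅ t)

max0-nonneg : ∀ {i} → 0ℤ ℤ.≤ i → max0 i ≡ ∣ i ∣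
max0-nonneg (+≤+ _) = refl

max0-neg : ∀ {i} → ¬ (0ℤ ℤ.≤ i) → max0 i ≡ 0
max0-neg {+ _} i≱0 with () ← i≱0 (+≤+ z≤n)
max0-neg { -[1+ _ ]} _ = refl

max0≤⇒≤+ : ∀ {i v} → max0 i ≤ v → i ℤ.≤ + v
max0≤⇒≤+ {+ _} le = +≤+ le
max0≤⇒≤+ { -[1+ _ ]} _ = -≤+

≤+⇒max0≤ : ∀ {i v} → i ℤ.≤ + v → max0 i ≤ v
≤+⇒max0≤ {+ _} le = ℤₚ.drop‿+≤+ le
≤+⇒max0≤ { -[1+ _ ]} _ = z≤n

+≤⇒≤- : ∀ {i j} z → i + z ℤ.≤ j → i ℤ.≤ j - z
+≤⇒≤- {i} {j} z le = subst (ℤ._≤ j - z) (//-rightDividesʳ z i) (ℤₚ.+-monoˡ-≤ (ℤ.- z) le)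

≤-⇒+≤ : ∀ {i j} z → i ℤ.≤ j - z → i + z ℤ.≤ j
≤-⇒+≤ {i} {j} z le = subst (i + z ℤ.≤_) (//-rightDividesˡ z j) (ℤₚ.+-monoˡ-≤ z le)

+≤∣∣⇒≤ : ∀ {b i} → 0ℤ ℤ.≤ i → b ≤ ∣ i ∣ → + b ℤ.≤ i
+≤∣∣⇒≤ i≥0 le = subst (_ ℤ.≤_) (ℤₚ.0≤i⇒+∣i∣≡i i≥0) (+≤+ le)

stepC-nonneg : ∀ {V p z q u} → (p , z , q) ∈ Δ V → 0ℤ ℤ.≤ + u + z →
               StepC V (p , u) (q , max0 (+ u + z))
stepC-nonneg {V} {p} {u = u} t ge =
  subst (λ w → StepC V (p , u) (_ , w)) (sym (max0-nonneg ge)) (stepC t ge)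

StepC⇒StepM : ∀ {V x y} → StepC V x y → StepM V x y
StepC⇒StepM {V} {p , _} (stepC t ge) =
  subst (λ w → StepM V (p , _) (_ , w)) (max0-nonneg ge) (stepM t)

ReachC⇒ReachM : ∀ {V x y} → ReachC V x y → ReachM V x y
ReachC⇒ReachM ε = ε
ReachC⇒ReachM (s ◅ r) = StepC⇒StepM s ◅ ReachC⇒ReachM r

StepM⇒StepC-rev : ∀ {V p z q u v} → (p , z , q) ∈ Δ V → max0 (+ u + z) ≤ v →
                  ∃[ x ] (u ≤ x × StepC (rev V) (q , v) (p , x))
StepM⇒StepC-rev {z = z} {u = u} {v} t le =
  ∣ + v - z ∣ , ℤₚ.drop‿+≤+ (subst (+ u ℤ.≤_) (sym (ℤₚ.0≤i⇒+∣i∣≡i v-z≥0)) u≤v-z) ,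
  stepC (∈-map⁺ revTrans t) v-z≥0
  where
  u≤v-z : + u ℤ.≤ + v - z
  u≤v-z = +≤⇒≤- z (max0≤⇒≤+ le)
  v-z≥0 : 0ℤ ℤ.≤ + v - z
  v-z≥0 = ℤₚ.≤-trans (+≤+ z≤n) u≤v-z

StepC-rev⇒StepM : ∀ {V q a r c b} → StepC (rev V) (q , a) (r , c) → b ≤ c →
                  ∃[ b′ ] (b′ ≤ a × StepM V (r , b) (q , b′))
StepC-rev⇒StepM (stepC t ge) b≤c with ∈-map⁻ revTrans t
... | (_ , z , _) , t′ , refl =
  _ , ≤+⇒max0≤ (≤-⇒+≤ z (+≤∣∣⇒≤ ge b≤c)) , stepM t′

ReachC-rev⇒ReachM : ∀ {V q a p v u} → ReachC (rev V) (q , a) (p , v) → u ≤ v →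
                    ∃[ b ] (b ≤ a × ReachM V (p , u) (q , b))
ReachC-rev⇒ReachM ε u≤v = _ , u≤v , ε
ReachC-rev⇒ReachM (s ◅ r) u≤v with ReachC-rev⇒ReachM r u≤v
... | b , b≤c , r′ with StepC-rev⇒StepM s b≤c
...   | b′ , b′≤a , s′ = b′ , b′≤a , r′ ◅◅ (s′ ◅ ε)

CoverC-rev⇒ReachM-zero : ∀ {V q s m} → CoverC (rev V) q 0 s m → ReachM V (s , m) (q , 0)
CoverC-rev⇒ReachM-zero (_ , m≤m′ , r) with ReachC-rev⇒ReachM r m≤m′
... | 0 , _ , r′ = r′

CoverCOrReset : (V : VASS1) → State V → ℕ → State V → ℕ → Set
CoverCOrReset V s m t n =
  CoverC V s m t n ⊎ ∃[ q ] (CoverC V q 0 t n × CoverC (rev V) q 0 s m)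

CoverCOrReset-◅ : ∀ {V p u p′ u′ t n} → StepM V (p , u) (p′ , u′) →
                  CoverCOrReset V p′ u′ t n → CoverCOrReset V p u t n
CoverCOrReset-◅ {u = u} (stepM {z = z} t) (inj₁ (n′ , n≤n′ , r)) with 0ℤ ℤ.≤? + u + z
... | yes ge = inj₁ (n′ , n≤n′ , stepC-nonneg t ge ◅ r)
-- the step truncates, so its target p′(0) is the reset state
... | no ng with StepM⇒StepC-rev t (≤-reflexive (max0-neg ng))
...   | x , u≤x , s =
  inj₂ (_ , (n′ , n≤n′ , subst (λ w → ReachC _ (_ , w) _) (max0-neg ng) r) , (x , u≤x , s ◅ ε))
CoverCOrReset-◅ (stepM t) (inj₂ (q , c , (v , u′≤v , r))) with StepM⇒StepC-rev t u′≤v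
... | x , u≤x , s = inj₂ (q , c , (x , u≤x , r ◅◅ (s ◅ ε)))

ReachM⇒CoverCOrReset : ∀ {V p u t n n′} → n ≤ n′ → ReachM V (p , u) (t , n′) →
                       CoverCOrReset V p u t n
ReachM⇒CoverCOrReset n≤n′ ε = inj₁ (_ , n≤n′ , ε)
ReachM⇒CoverCOrReset n≤n′ (s ◅ r) =
  CoverCOrReset-◅ s (ReachM⇒CoverCOrReset n≤n′ r)

CoverCOrReset⇒CoverM : ∀ {V s m t n} → CoverCOrReset V s m t n → CoverM V s m t n
CoverCOrReset⇒CoverM (inj₁ (n′ , n≤n′ , r)) = n′ , n≤n′ , ReachC⇒ReachM r
CoverCOrReset⇒CoverM (inj₂ (_ , (n′ , n≤n′ , r) , c)) =
  n′ , n≤n′ , CoverC-rev⇒ReachM-zero c ◅◅ ReachC⇒ReachM r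

lemma22 : (V : VASS1) (s t : State V) (m n : ℕ) →
    CoverM V s m t n ⇔
      (CoverC V s m t n ⊎
       (∃[ q ] (CoverC V q 0 t n × CoverC (rev V) q 0 s m)))
lemma22 V s t m n =
  mk⇔ (λ (_ , n≤n′ , r) → ReachM⇒CoverCOrReset n≤n′ r) CoverCOrReset⇒CoverM
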